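{- Let $m\ge 2$, let $\delta_i=(\neg a_i\vee b_i)\wedge(\neg a_i\vee c_i)\wedge(\neg b_i\vee\neg c_i\vee d_i)$ for $i=1,\dots,m$, and let $\gamma'_m=\left(\bigvee_{i=1}^m a_i\right)\wedge\bigwedge_{i=1}^m\delta_i\wedge\bigwedge_{i=1}^m(\neg a_i\vee d_i)$. Then $\gamma'_m$ is a PC formula.
   Context: A partial assignment is a set of literals with no complementary pair, identified with their conjunction; $\vdash_1$ denotes derivability by repeated unit resolution (deriving $C\setminus\{l\}$ from $C\ni l$ and $\neg l$); $\bot$ is the empty clause. A CNF $\varphi(\mathbf{z})$ is PC if for every partial assignment $\alpha$ of $\mathbf{z}$ and literal $l$ on $\mathbf{z}$ with $\varphi\wedge\alpha\models l$, $\varphi\wedge\alpha\vdash_1 l$ or $\varphi\wedge\alpha\vdash_1\bot$. -}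

module Defs where

open import Data.Nat using (ℕ)
open import Data.Fin using (Fin)
open import Data.Fin.Properties using () renaming (_≟_ to _≟F_)
open import Data.Bool using (Bool; true; false; not)
open import Data.List using (List; []; _∷_; [_]; filter; map; concat; _++_)
open import Data.List.Relation.Unary.All using (All)
open import Data.List.Relation.Unary.Any using (Any)
open import Data.List.Membership.Propositional using (_∈_)
open import Data.Fin using (Fin)
open import Data.Vec.Functional using ()
open import Data.List using (allFin)
open import Data.Empty using (⊥)
open import Data.Sum using (_⊎_)
open import Relation.Nullary using (Dec; yes; no; ¬_)
open import Relation.Binary.PropositionalEquality using (_≡_; refl; cong; cong₂)

data Lit (V : Set) : Set where
  pos : V → Lit V
  neg : V → Lit V

compl : {V : Set} → Lit V → Lit V
compl (pos x) = neg x
compl (neg x) = pos x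

Clause : Set → Set
Clause V = List (Lit V)

CNF : Set → Set
CNF V = List (Clause V)

DecEq : Set → Set
DecEq V = (x y : V) → Dec (x ≡ y)

module _ {V : Set} (_≟V_ : DecEq V) where

  _≟L_ : DecEq (Lit V)
  pos x ≟L pos y with x ≟V y
  ... | yes refl = yes refl
  ... | no ne = no λ { refl → ne refl }
  neg x ≟L neg y with x ≟V y
  ... | yes refl = yes refl
  ... | no ne = no λ { refl → ne refl }
  pos x ≟L neg y = no λ ()
  neg x ≟L pos y = no λ ()

  -- C \ {l}  (remove every occurrence of l; clauses are read as sets)
  remove : Lit V → Clause V → Clause V
  remove l C = filter (λ k → Relation.Nullary.¬? (k ≟L l)) C

  data UnitDerivable (φ : CNF V) (α : List (Lit V)) : Clause V → Set where
    axiom   : ∀ {C} → C ∈ φ → UnitDerivable φ α C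
    assume  : ∀ {l} → l ∈ α → UnitDerivable φ α [ l ]
    resolve : ∀ {C l} → UnitDerivable φ α C → l ∈ C →
              UnitDerivable φ α [ compl l ] →
              UnitDerivable φ α (remove l C)

  _∧_⊢₁_ : CNF V → List (Lit V) → Clause V → Set
  φ ∧ α ⊢₁ C = UnitDerivable φ α C

evalLit : {V : Set} → (V → Bool) → Lit V → Bool
evalLit τ (pos x) = τ x
evalLit τ (neg x) = not (τ x)

SatLit : {V : Set} → (V → Bool) → Lit V → Set
SatLit τ l = evalLit τ l ≡ true

SatClause : {V : Set} → (V → Bool) → Clause V → Set
SatClause τ C = Any (SatLit τ) C

SatCNF : {V : Set} → (V → Bool) → CNF V → Set
SatCNF τ φ = All (SatClause τ) φ

-- Partial assignment: a list of literals with no complementary pair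
Consistent : {V : Set} → List (Lit V) → Set
Consistent α = ∀ l → l ∈ α → compl l ∈ α → ⊥

_∧_⊨_ : {V : Set} → CNF V → List (Lit V) → Lit V → Set
φ ∧ α ⊨ l = ∀ τ → SatCNF τ φ → All (SatLit τ) α → SatLit τ l

IsPC : {V : Set} → DecEq V → CNF V → Set
IsPC {V} eq φ = (α : List (Lit V)) → Consistent α → (l : Lit V) →
  φ ∧ α ⊨ l → (_∧_⊢₁_ eq φ α [ l ]) ⊎ (_∧_⊢₁_ eq φ α [])

data Kind : Set where
  kA kB kC kD : Kind

_≟K_ : DecEq Kind
kA ≟K kA = yes refl
kB ≟K kB = yes refl
kC ≟K kC = yes refl
kD ≟K kD = yes refl
kA ≟K kB = no λ ()
kA ≟K kC = no λ ()
kA ≟K kD = no λ ()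
kB ≟K kA = no λ ()
kB ≟K kC = no λ ()
kB ≟K kD = no λ ()
kC ≟K kA = no λ ()
kC ≟K kB = no λ ()
kC ≟K kD = no λ ()
kD ≟K kA = no λ ()
kD ≟K kB = no λ ()
kD ≟K kC = no λ ()

data GVar (m : ℕ) : Set where
  var : Kind → Fin m → GVar m

a b c d : {m : ℕ} → Fin m → GVar m
a i = var kA i
b i = var kB i
c i = var kC i
d i = var kD i

_≟G_ : {m : ℕ} → DecEq (GVar m)
var k i ≟G var k' j with k ≟K k' | i ≟F j
... | yes refl | yes refl = yes refl
... | no ne | _ = no λ { refl → ne refl }
... | yes _ | no ne = no λ { refl → ne refl }

δ : {m : ℕ} → Fin m → CNF (GVar m)
δ i = (neg (a i) ∷ pos (b i) ∷ [])
    ∷ (neg (a i) ∷ pos (c i) ∷ [])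
    ∷ (neg (b i) ∷ neg (c i) ∷ pos (d i) ∷ [])
    ∷ []

γ′ : (m : ℕ) → CNF (GVar m)
γ′ m = map (λ i → pos (a i)) (allFin m)
     ∷ (concat (map δ (allFin m))
        ++ map (λ i → neg (a i) ∷ pos (d i) ∷ []) (allFin m))

-- Apart from the clause a₁ ∨ … ∨ a_m, γ′ is a Horn formula, and on the variables of one block
-- the least model of its Horn part containing the positive literals of α is exactly what unit
-- propagation derives from α.  If α contains a conflict inside one block, or refutes every a_k,
-- unit propagation derives ⊥.  Otherwise some block j is free (has no negative literal in α), and the
-- least model of α together with a_j satisfies γ′ ∧ α.  Hence an entailed positive literal on a
-- block i ≠ j holds in the least model of α alone and is propagated; if no such j exists, a_i
-- itself is propagated from the big clause.  For an entailed ¬x_i with block i not free,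
-- adding x_i to the seed gives a model falsifying ¬x_i unless it violates a negative literal of α,
-- and each possible violation propagates ¬x_i.

module Submission where

open import Defs
open import Data.Nat using (ℕ; _≤_)
open import Data.Bool using (Bool; not)
open import Data.Empty using (⊥)
open import Data.Fin using (Fin)
open import Data.Fin.Properties using (any?; all?; ¬∀⟶∃¬) renaming (_≟_ to _≟F_)
open import Data.List using (List; []; _∷_; [_]; _++_; filter; map; concat; allFin)
open import Data.List.Properties using (filter-accept; filter-reject; filter-all; filter-none; filter-++; ++-assoc)
open import Data.List.Relation.Unary.All as All using (All; []; _∷_)
open import Data.List.Relation.Unary.All.Properties using (++⁺; concat⁺; map⁺; ¬All⇒Any¬)
open import Data.List.Relation.Unary.Any using (here; there)
open import Data.List.Relation.Unary.Unique.Propositional using (Unique; []; _∷_)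
import Data.List.Relation.Unary.Unique.Propositional.Properties as Unique
open import Data.List.Membership.Propositional using (_∈_; lose; find)
open import Data.List.Membership.Propositional.Properties using (∈-map⁺; ∈-++⁺ˡ; ∈-++⁺ʳ; ∈-concat⁺′; ∈-allFin)
open import Data.Product as Product using (_×_; _,_; ∃-syntax)
open import Data.Sum as Sum using (_⊎_; inj₁; inj₂)
open import Data.Unit using (⊤; tt)
open import Function using (case_of_)
open import Relation.Nullary using (Dec; yes; no; ¬_; does; contradiction)
open import Relation.Nullary.Decidable using (_×-dec_; _⊎-dec_; ¬?; dec-true; dec-false; decidable-stable)
open import Relation.Unary using (Decidable)
open import Relation.Binary.PropositionalEquality using (_≡_; _≢_; refl; sym; trans; cong; cong₂; subst)
open Relation.Binary.PropositionalEquality.≡-Reasoning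

filter-≟-unique : {A : Set} (_≟A_ : DecEq A) {l : A} {C : List A} →
                  Unique C → l ∈ C → filter (_≟A l) C ≡ [ l ]
filter-≟-unique _≟A_ {l} (l∉C ∷ _) (here refl) =
  trans (filter-accept (_≟A l) refl)
        (cong (l ∷_) (filter-none (_≟A l) (All.map (λ l≢x x≡l → l≢x (sym x≡l)) l∉C)))
filter-≟-unique _≟A_ {l} (x∉C ∷ C!) (there l∈C) =
  trans (filter-reject (_≟A l) (All.lookup x∉C l∈C)) (filter-≟-unique _≟A_ C! l∈C)

unique₂ : {A : Set} {x y : A} → x ≢ y → Unique (x ∷ y ∷ [])
unique₂ x≢y = (x≢y ∷ []) ∷ [] ∷ []

unique₃ : {A : Set} {x y z : A} → x ≢ y → x ≢ z → y ≢ z → Unique (x ∷ y ∷ z ∷ [])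
unique₃ x≢y x≢z y≢z = (x≢y ∷ x≢z ∷ []) ∷ (y≢z ∷ []) ∷ [] ∷ []

module UnitResolution {V : Set} (_≟V_ : DecEq V) (φ : CNF V) (α : List (Lit V)) where

  ⊢_ : Clause V → Set
  ⊢ C = _∧_⊢₁_ _≟V_ φ α C

  Refuted : Lit V → Set
  Refuted x = ⊢ [ compl x ]

  remove-middle : ∀ {x} K C → All (_≢ x) K → All (_≢ x) C →
                  remove _≟V_ x (K ++ x ∷ C) ≡ K ++ C
  remove-middle {x} K C K∌x C∌x = begin
    remove _≟V_ x (K ++ x ∷ C)                       ≡⟨ filter-++ ≢x? K (x ∷ C) ⟩
    remove _≟V_ x K ++ remove _≟V_ x (x ∷ C)         ≡⟨ cong₂ _++_ (filter-all ≢x? K∌x) (filter-reject ≢x? (λ x≢x → x≢x refl)) ⟩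
    K ++ remove _≟V_ x C                             ≡⟨ cong (K ++_) (filter-all ≢x? C∌x) ⟩
    K ++ C                                           ∎
    where
    ≢x? : Decidable (_≢ x)
    ≢x? k = ¬? (_≟L_ _≟V_ k x)

  -- Resolving on x removes only its displayed occurrence: x ∉ C by uniqueness, and x ∉ K
  -- because the literals of K satisfy P.
  resolve-away : {P : Lit V → Set} (P? : Decidable P) {K : Clause V} (C : Clause V) →
                 All P K → Unique C → All (λ x → P x ⊎ Refuted x) C →
                 ⊢ (K ++ C) → ⊢ (K ++ filter P? C)
  resolve-away P? [] _ _ _ ⊢K = ⊢K
  resolve-away {P} P? {K} (x ∷ C) PK (x∉C ∷ C!) (Px⊎¬x ∷ rest) ⊢KxC =
    case P? x of λ where
      (yes Px) → keep Px
      (no ¬Px) → drop ¬Px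
    where
    keep : P x → ⊢ (K ++ filter P? (x ∷ C))
    keep Px = subst ⊢_ (trans (++-assoc K [ x ] (filter P? C)) (cong (K ++_) (sym (filter-accept P? Px))))
                (resolve-away P? C (++⁺ PK (Px ∷ [])) C! rest (subst ⊢_ (sym (++-assoc K [ x ] C)) ⊢KxC))

    drop : ¬ P x → ⊢ (K ++ filter P? (x ∷ C))
    drop ¬Px = subst ⊢_ (cong (K ++_) (sym (filter-reject P? ¬Px))) (resolve-away P? C PK C! rest ⊢KC)
      where
      ⊢¬x : Refuted x
      ⊢¬x = Sum.fromInj₂ (λ Px → contradiction Px ¬Px) Px⊎¬x

      ⊢KC : ⊢ (K ++ C)
      ⊢KC = subst ⊢_ (remove-middle K C (All.map (λ Pk k≡x → ¬Px (subst P k≡x Pk)) PK)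
                                         (All.map (λ x≢k k≡x → x≢k (sym k≡x)) x∉C))
                     (resolve ⊢KxC (∈-++⁺ʳ K (here refl)) ⊢¬x)

  propagate : ∀ {l C} → Unique C → l ∈ C → All (λ x → x ≡ l ⊎ Refuted x) C → ⊢ C → ⊢ [ l ]
  propagate {l} {C} C! l∈C rs ⊢C =
    subst ⊢_ (filter-≟-unique (_≟L_ _≟V_) C! l∈C) (resolve-away (λ x → _≟L_ _≟V_ x l) {[]} C [] C! rs ⊢C)

  refute : ∀ {C} → Unique C → All Refuted C → ⊢ C → ⊢ []
  refute {C} C! rs ⊢C =
    subst ⊢_ (filter-none none? (All.universal (λ _ ()) C))
             (resolve-away none? {[]} C [] C! (All.map inj₂ rs) ⊢C)
    where
    none? : Decidable (λ (_ : Lit V) → ⊥)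
    none? _ = no λ ()

  clash : ∀ {l} → ⊢ [ l ] → ⊢ [ compl l ] → ⊢ []
  clash {l} ⊢l ⊢¬l =
    subst ⊢_ (filter-reject (λ k → ¬? (_≟L_ _≟V_ k l)) (λ l≢l → l≢l refl)) (resolve ⊢l (here refl) ⊢¬l)

module DecidableAssignment {V : Set} {Q : V → Set} (Q? : Decidable Q) where

  assignment : V → Bool
  assignment v = does (Q? v)

  sat-pos : ∀ {v} → Q v → SatLit assignment (pos v)
  sat-pos {v} q = dec-true (Q? v) q

  sat-neg : ∀ {v} → ¬ Q v → SatLit assignment (neg v)
  sat-neg {v} ¬q = cong not (dec-false (Q? v) ¬q)

  sat-pos⁻ : ∀ {v} → SatLit assignment (pos v) → Q v
  sat-pos⁻ {v} holds = decidable-stable (Q? v) λ ¬q → contradiction (trans (sym holds) (dec-false (Q? v) ¬q)) λ ()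

  sat-neg⁻ : ∀ {v} → SatLit assignment (neg v) → ¬ Q v
  sat-neg⁻ {v} holds q = contradiction (trans (sym holds) (cong not (dec-true (Q? v) q))) λ ()

  sat-horn₂ : ∀ {x y} → (Q x → Q y) → SatClause assignment (neg x ∷ pos y ∷ [])
  sat-horn₂ {x} x⇒y = case Q? x of λ where
    (yes qx) → there (here (sat-pos (x⇒y qx)))
    (no ¬qx) → here (sat-neg ¬qx)

  sat-horn₃ : ∀ {x y z} → (Q x → Q y → Q z) → SatClause assignment (neg x ∷ neg y ∷ pos z ∷ [])
  sat-horn₃ {x} {y} xy⇒z = case Q? x of λ where
    (no ¬qx) → here (sat-neg ¬qx)
    (yes qx) → case Q? y of λ where
      (no ¬qy) → there (here (sat-neg ¬qy))
      (yes qy) → there (there (here (sat-pos (xy⇒z qx qy))))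

module _ {m : ℕ} where

  open import Data.List.Membership.DecPropositional (_≟L_ (_≟G_ {m})) using (_∈?_)

  ⋁a : Clause (GVar m)
  ⋁a = map (λ i → pos (a i)) (allFin m)

  ⋁a-unique : Unique ⋁a
  ⋁a-unique = Unique.map⁺ (λ { refl → refl }) (Unique.allFin⁺ m)

  δ⊆γ′ : ∀ {C} k → C ∈ δ k → C ∈ γ′ m
  δ⊆γ′ k C∈δ = there (∈-++⁺ˡ (∈-concat⁺′ C∈δ (∈-map⁺ δ (∈-allFin k))))

  ¬a∨d∈γ′ : ∀ k → (neg (a k) ∷ pos (d k) ∷ []) ∈ γ′ m
  ¬a∨d∈γ′ k = there (∈-++⁺ʳ (concat (map δ (allFin m))) (∈-map⁺ (λ i → neg (a i) ∷ pos (d i) ∷ []) (∈-allFin k)))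

  -- ⟦ σ ⟧ below is the least model of the Horn part of γ′ (the δ_k and the ¬a_k ∨ d_k)
  -- in which the positive literals of σ hold.
  Holds : List (Lit (GVar m)) → GVar m → Set
  Holds σ (var kA k) = pos (a k) ∈ σ
  Holds σ (var kB k) = pos (a k) ∈ σ ⊎ pos (b k) ∈ σ
  Holds σ (var kC k) = pos (a k) ∈ σ ⊎ pos (c k) ∈ σ
  Holds σ (var kD k) = pos (a k) ∈ σ ⊎ pos (d k) ∈ σ ⊎ (pos (b k) ∈ σ × pos (c k) ∈ σ)

  holds? : ∀ σ → Decidable (Holds σ)
  holds? σ (var kA k) = pos (a k) ∈? σ
  holds? σ (var kB k) = pos (a k) ∈? σ ⊎-dec pos (b k) ∈? σ
  holds? σ (var kC k) = pos (a k) ∈? σ ⊎-dec pos (c k) ∈? σ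
  holds? σ (var kD k) = pos (a k) ∈? σ ⊎-dec (pos (d k) ∈? σ ⊎-dec (pos (b k) ∈? σ ×-dec pos (c k) ∈? σ))

  ⟦_⟧ : List (Lit (GVar m)) → GVar m → Bool
  ⟦ σ ⟧ = DecidableAssignment.assignment (holds? σ)

  Holds-extensive : ∀ {σ v} → pos v ∈ σ → Holds σ v
  Holds-extensive {v = var kA _} p = p
  Holds-extensive {v = var kB _} p = inj₂ p
  Holds-extensive {v = var kC _} p = inj₂ p
  Holds-extensive {v = var kD _} p = inj₂ (inj₁ p)

  Holds-of-a : ∀ {σ k} y → pos (a k) ∈ σ → Holds σ (var y k)
  Holds-of-a kA p = p
  Holds-of-a kB p = inj₁ p
  Holds-of-a kC p = inj₁ p
  Holds-of-a kD p = inj₁ p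

  Holds-mono : ∀ {σ σ′ k} y → (∀ {z} → pos (var z k) ∈ σ → pos (var z k) ∈ σ′) →
               Holds σ (var y k) → Holds σ′ (var y k)
  Holds-mono kA σ⊆σ′ = σ⊆σ′
  Holds-mono kB σ⊆σ′ = Sum.map σ⊆σ′ σ⊆σ′
  Holds-mono kC σ⊆σ′ = Sum.map σ⊆σ′ σ⊆σ′
  Holds-mono kD σ⊆σ′ = Sum.map σ⊆σ′ (Sum.map σ⊆σ′ (Product.map σ⊆σ′ σ⊆σ′))

  Holds-other-block : ∀ {σ k j w} y → k ≢ j → Holds (pos (var w j) ∷ σ) (var y k) → Holds σ (var y k)
  Holds-other-block {k = k} {j} y k≢j = Holds-mono y drop-head
    where
    drop-head : ∀ {z σ w} → pos (var z k) ∈ pos (var w j) ∷ σ → pos (var z k) ∈ σ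
    drop-head (here refl) = contradiction refl k≢j
    drop-head (there p) = p

  closure-⊨-γ′ : ∀ {σ j} → pos (a j) ∈ σ → SatCNF ⟦ σ ⟧ (γ′ m)
  closure-⊨-γ′ {σ} {j} a∈σ =
    lose (∈-map⁺ (λ i → pos (a i)) (∈-allFin j)) (sat-pos a∈σ)
    ∷ ++⁺ (concat⁺ (map⁺ (All.universal δ-sat (allFin m))))
          (map⁺ (All.universal (λ _ → sat-horn₂ inj₁) (allFin m)))
    where
    open DecidableAssignment (holds? σ)

    b⇒c⇒d : ∀ {k} → Holds σ (b k) → Holds σ (c k) → Holds σ (d k)
    b⇒c⇒d (inj₁ ha) _ = inj₁ ha
    b⇒c⇒d (inj₂ _) (inj₁ ha) = inj₁ ha
    b⇒c⇒d (inj₂ hb) (inj₂ hc) = inj₂ (inj₂ (hb , hc))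

    δ-sat : ∀ k → All (SatClause ⟦ σ ⟧) (δ k)
    δ-sat k = sat-horn₂ inj₁ ∷ sat-horn₂ inj₁ ∷ sat-horn₃ b⇒c⇒d ∷ []

module Completeness {m : ℕ} (α : List (Lit (GVar m))) (α-consistent : Consistent α) where

  open UnitResolution _≟G_ (γ′ m) α
  open import Data.List.Membership.DecPropositional (_≟L_ (_≟G_ {m})) using (_∈?_)
  open DecidableAssignment using (sat-pos⁻; sat-neg⁻)

  ⊢a⇒⊢b : ∀ {k} → ⊢ [ pos (a k) ] → ⊢ [ pos (b k) ]
  ⊢a⇒⊢b {k} ⊢a = propagate (unique₂ λ ()) (there (here refl)) (inj₂ ⊢a ∷ inj₁ refl ∷ [])
                           (axiom (δ⊆γ′ k (here refl)))

  ⊢a⇒⊢c : ∀ {k} → ⊢ [ pos (a k) ] → ⊢ [ pos (c k) ]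
  ⊢a⇒⊢c {k} ⊢a = propagate (unique₂ λ ()) (there (here refl)) (inj₂ ⊢a ∷ inj₁ refl ∷ [])
                           (axiom (δ⊆γ′ k (there (here refl))))

  ⊢a⇒⊢d : ∀ {k} → ⊢ [ pos (a k) ] → ⊢ [ pos (d k) ]
  ⊢a⇒⊢d {k} ⊢a = propagate (unique₂ λ ()) (there (here refl)) (inj₂ ⊢a ∷ inj₁ refl ∷ [])
                           (axiom (¬a∨d∈γ′ k))

  ⊢¬b⇒⊢¬a : ∀ {k} → ⊢ [ neg (b k) ] → ⊢ [ neg (a k) ]
  ⊢¬b⇒⊢¬a {k} ⊢¬b = propagate (unique₂ λ ()) (here refl) (inj₁ refl ∷ inj₂ ⊢¬b ∷ [])
                              (axiom (δ⊆γ′ k (here refl)))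

  ⊢¬c⇒⊢¬a : ∀ {k} → ⊢ [ neg (c k) ] → ⊢ [ neg (a k) ]
  ⊢¬c⇒⊢¬a {k} ⊢¬c = propagate (unique₂ λ ()) (here refl) (inj₁ refl ∷ inj₂ ⊢¬c ∷ [])
                              (axiom (δ⊆γ′ k (there (here refl))))

  ⊢¬d⇒⊢¬a : ∀ {k} → ⊢ [ neg (d k) ] → ⊢ [ neg (a k) ]
  ⊢¬d⇒⊢¬a {k} ⊢¬d = propagate (unique₂ λ ()) (here refl) (inj₁ refl ∷ inj₂ ⊢¬d ∷ [])
                              (axiom (¬a∨d∈γ′ k))

  ⊢b⇒⊢c⇒⊢d : ∀ {k} → ⊢ [ pos (b k) ] → ⊢ [ pos (c k) ] → ⊢ [ pos (d k) ]
  ⊢b⇒⊢c⇒⊢d {k} ⊢b ⊢c = propagate (unique₃ (λ ()) (λ ()) (λ ())) (there (there (here refl)))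
                                 (inj₂ ⊢b ∷ inj₂ ⊢c ∷ inj₁ refl ∷ []) (axiom (δ⊆γ′ k (there (there (here refl)))))

  ⊢c⇒⊢¬d⇒⊢¬b : ∀ {k} → ⊢ [ pos (c k) ] → ⊢ [ neg (d k) ] → ⊢ [ neg (b k) ]
  ⊢c⇒⊢¬d⇒⊢¬b {k} ⊢c ⊢¬d = propagate (unique₃ (λ ()) (λ ()) (λ ())) (here refl)
                                    (inj₁ refl ∷ inj₂ ⊢c ∷ inj₂ ⊢¬d ∷ []) (axiom (δ⊆γ′ k (there (there (here refl)))))

  ⊢b⇒⊢¬d⇒⊢¬c : ∀ {k} → ⊢ [ pos (b k) ] → ⊢ [ neg (d k) ] → ⊢ [ neg (c k) ]
  ⊢b⇒⊢¬d⇒⊢¬c {k} ⊢b ⊢¬d = propagate (unique₃ (λ ()) (λ ()) (λ ())) (there (here refl))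
                                    (inj₂ ⊢b ∷ inj₁ refl ∷ inj₂ ⊢¬d ∷ []) (axiom (δ⊆γ′ k (there (there (here refl)))))

  ⊢a⇒⊢block : ∀ {k} y → ⊢ [ pos (a k) ] → ⊢ [ pos (var y k) ]
  ⊢a⇒⊢block kA ⊢a = ⊢a
  ⊢a⇒⊢block kB ⊢a = ⊢a⇒⊢b ⊢a
  ⊢a⇒⊢block kC ⊢a = ⊢a⇒⊢c ⊢a
  ⊢a⇒⊢block kD ⊢a = ⊢a⇒⊢d ⊢a

  Holds-α⇒⊢ : ∀ {v} → Holds α v → ⊢ [ pos v ]
  Holds-α⇒⊢ {var kA _} ha = assume ha
  Holds-α⇒⊢ {var kB _} (inj₁ ha) = ⊢a⇒⊢b (assume ha)
  Holds-α⇒⊢ {var kB _} (inj₂ hb) = assume hb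
  Holds-α⇒⊢ {var kC _} (inj₁ ha) = ⊢a⇒⊢c (assume ha)
  Holds-α⇒⊢ {var kC _} (inj₂ hc) = assume hc
  Holds-α⇒⊢ {var kD _} (inj₁ ha) = ⊢a⇒⊢d (assume ha)
  Holds-α⇒⊢ {var kD _} (inj₂ (inj₁ hd)) = assume hd
  Holds-α⇒⊢ {var kD _} (inj₂ (inj₂ (hb , hc))) = ⊢b⇒⊢c⇒⊢d (assume hb) (assume hc)

  Blocked : Fin m → Set
  Blocked k = ∃[ y ] neg (var y k) ∈ α

  blocked? : Decidable Blocked
  blocked? k with neg (a k) ∈? α | neg (b k) ∈? α | neg (c k) ∈? α | neg (d k) ∈? α
  ... | yes p | _ | _ | _ = yes (kA , p)
  ... | no _ | yes p | _ | _ = yes (kB , p)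
  ... | no _ | no _ | yes p | _ = yes (kC , p)
  ... | no _ | no _ | no _ | yes p = yes (kD , p)
  ... | no ¬a | no ¬b | no ¬c | no ¬d = no λ where
    (kA , p) → ¬a p
    (kB , p) → ¬b p
    (kC , p) → ¬c p
    (kD , p) → ¬d p

  ⊢¬a-of-blocked : ∀ {k} → Blocked k → ⊢ [ neg (a k) ]
  ⊢¬a-of-blocked (kA , p) = assume p
  ⊢¬a-of-blocked (kB , p) = ⊢¬b⇒⊢¬a (assume p)
  ⊢¬a-of-blocked (kC , p) = ⊢¬c⇒⊢¬a (assume p)
  ⊢¬a-of-blocked (kD , p) = ⊢¬d⇒⊢¬a (assume p)

  ⊢a-of-others-blocked : ∀ i → (∀ j → j ≢ i → Blocked j) → ⊢ [ pos (a i) ]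
  ⊢a-of-others-blocked i others =
    propagate ⋁a-unique (∈-map⁺ (λ j → pos (a j)) (∈-allFin i)) (map⁺ (All.universal resolvable (allFin m)))
              (axiom (here refl))
    where
    resolvable : ∀ j → pos (a j) ≡ pos (a i) ⊎ Refuted (pos (a j))
    resolvable j = case j ≟F i of λ where
      (yes refl) → inj₁ refl
      (no j≢i) → inj₂ (⊢¬a-of-blocked (others j j≢i))

  LocalConflict : Fin m → Set
  LocalConflict k = (pos (a k) ∈ α × Blocked k) ⊎ (pos (b k) ∈ α × pos (c k) ∈ α × neg (d k) ∈ α)

  Conflict : Set
  Conflict = (∃[ k ] LocalConflict k) ⊎ (∀ k → Blocked k)

  conflict? : Dec Conflict
  conflict? = any? localConflict? ⊎-dec all? blocked?
    where
    localConflict? : Decidable LocalConflict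
    localConflict? k = (pos (a k) ∈? α ×-dec blocked? k)
                       ⊎-dec (pos (b k) ∈? α ×-dec (pos (c k) ∈? α ×-dec neg (d k) ∈? α))

  ⊢⊥-of-conflict : Conflict → ⊢ []
  ⊢⊥-of-conflict (inj₁ (_ , inj₁ (ha , bl))) = clash (assume ha) (⊢¬a-of-blocked bl)
  ⊢⊥-of-conflict (inj₁ (_ , inj₂ (hb , hc , h¬d))) = clash (⊢b⇒⊢c⇒⊢d (assume hb) (assume hc)) (assume h¬d)
  ⊢⊥-of-conflict (inj₂ all-blocked) =
    refute ⋁a-unique (map⁺ (All.universal (λ k → ⊢¬a-of-blocked (all-blocked k)) (allFin m))) (axiom (here refl))

  Respected : List (Lit (GVar m)) → Lit (GVar m) → Set
  Respected σ (pos _) = ⊤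
  Respected σ (neg v) = ¬ Holds σ v

  respected? : ∀ σ → Decidable (Respected σ)
  respected? σ (pos _) = yes tt
  respected? σ (neg v) = ¬? (holds? σ v)

  ⊨⇒closure : ∀ {j} β ℓ → pos (a j) ∈ β → All (Respected (β ++ α)) α → γ′ m ∧ α ⊨ ℓ → SatLit ⟦ β ++ α ⟧ ℓ
  ⊨⇒closure β _ a∈β respected ent = ent ⟦ β ++ α ⟧ (closure-⊨-γ′ (∈-++⁺ˡ a∈β)) (All.tabulate sat-α)
    where
    open DecidableAssignment (holds? (β ++ α)) using (sat-pos; sat-neg)

    sat-α : ∀ {ℓ} → ℓ ∈ α → SatLit ⟦ β ++ α ⟧ ℓ
    sat-α {pos _} p = sat-pos (Holds-extensive (∈-++⁺ʳ β p))
    sat-α {neg _} p = sat-neg (All.lookup respected p)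

  ⊨⇒Holds : ∀ {j} β v → pos (a j) ∈ β → All (Respected (β ++ α)) α → γ′ m ∧ α ⊨ pos v → Holds (β ++ α) v
  ⊨⇒Holds β v a∈β respected ent = sat-pos⁻ (holds? (β ++ α)) (⊨⇒closure β (pos v) a∈β respected ent)

  ⊨⇒¬Holds : ∀ {j} β v → pos (a j) ∈ β → All (Respected (β ++ α)) α → γ′ m ∧ α ⊨ neg v → ¬ Holds (β ++ α) v
  ⊨⇒¬Holds β v a∈β respected ent = sat-neg⁻ (holds? (β ++ α)) (⊨⇒closure β (neg v) a∈β respected ent)

  module ConflictFree (no-local : ∀ k → ¬ LocalConflict k) (free : ∃[ j ] ¬ Blocked j) where

    Holds-α-consistent : ∀ {v} → neg v ∈ α → ¬ Holds α v
    Holds-α-consistent {var kA _} n ha = α-consistent _ ha n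
    Holds-α-consistent {var kB k} n (inj₁ ha) = no-local k (inj₁ (ha , kB , n))
    Holds-α-consistent {var kB _} n (inj₂ hb) = α-consistent _ hb n
    Holds-α-consistent {var kC k} n (inj₁ ha) = no-local k (inj₁ (ha , kC , n))
    Holds-α-consistent {var kC _} n (inj₂ hc) = α-consistent _ hc n
    Holds-α-consistent {var kD k} n (inj₁ ha) = no-local k (inj₁ (ha , kD , n))
    Holds-α-consistent {var kD _} n (inj₂ (inj₁ hd)) = α-consistent _ hd n
    Holds-α-consistent {var kD k} n (inj₂ (inj₂ (hb , hc))) = no-local k (inj₂ (hb , hc , n))

    respects-free : ∀ {j} → ¬ Blocked j → All (Respected (pos (a j) ∷ α)) α
    respects-free {j} j-free = All.tabulate respected
      where
      respected : ∀ {ℓ} → ℓ ∈ α → Respected (pos (a j) ∷ α) ℓ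
      respected {pos _} _ = tt
      respected {neg (var y k)} n = case k ≟F j of λ where
        (yes refl) → contradiction (y , n) j-free
        (no k≢j) → λ h → Holds-α-consistent n (Holds-other-block y k≢j h)

    ⊢¬-of-a-in-seed : ∀ {i y} → Blocked i → pos (a i) ∈ pos (var y i) ∷ α → ⊢ [ neg (var y i) ]
    ⊢¬-of-a-in-seed bl (here refl) = ⊢¬a-of-blocked bl
    ⊢¬-of-a-in-seed {i} bl (there ha) = contradiction (inj₁ (ha , bl)) (no-local i)

    ⊢¬-of-seed-clash : ∀ {i y} z → Blocked i → neg (var z i) ∈ α →
                       Holds (pos (var y i) ∷ α) (var z i) → ⊢ [ neg (var y i) ]
    ⊢¬-of-seed-clash kA bl n ha = ⊢¬-of-a-in-seed bl ha
    ⊢¬-of-seed-clash kB bl n (inj₁ ha) = ⊢¬-of-a-in-seed bl ha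
    ⊢¬-of-seed-clash kB bl n (inj₂ (here refl)) = assume n
    ⊢¬-of-seed-clash kB bl n (inj₂ (there hb)) = contradiction n (α-consistent _ hb)
    ⊢¬-of-seed-clash kC bl n (inj₁ ha) = ⊢¬-of-a-in-seed bl ha
    ⊢¬-of-seed-clash kC bl n (inj₂ (here refl)) = assume n
    ⊢¬-of-seed-clash kC bl n (inj₂ (there hc)) = contradiction n (α-consistent _ hc)
    ⊢¬-of-seed-clash kD bl n (inj₁ ha) = ⊢¬-of-a-in-seed bl ha
    ⊢¬-of-seed-clash kD bl n (inj₂ (inj₁ (here refl))) = assume n
    ⊢¬-of-seed-clash kD bl n (inj₂ (inj₁ (there hd))) = contradiction n (α-consistent _ hd)
    ⊢¬-of-seed-clash kD bl n (inj₂ (inj₂ (here refl , here ())))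
    ⊢¬-of-seed-clash kD bl n (inj₂ (inj₂ (here refl , there hc))) = ⊢c⇒⊢¬d⇒⊢¬b (assume hc) (assume n)
    ⊢¬-of-seed-clash kD bl n (inj₂ (inj₂ (there hb , here refl))) = ⊢b⇒⊢¬d⇒⊢¬c (assume hb) (assume n)
    ⊢¬-of-seed-clash {i} kD bl n (inj₂ (inj₂ (there hb , there hc))) = contradiction (inj₂ (hb , hc , n)) (no-local i)

    ⊢-of-⊨-pos : ∀ {i} y → γ′ m ∧ α ⊨ pos (var y i) → ⊢ [ pos (var y i) ]
    ⊢-of-⊨-pos {i} y ent = case any? (λ j → ¬? (j ≟F i) ×-dec ¬? (blocked? j)) of λ where
      (yes (j , j≢i , j-free)) →
        Holds-α⇒⊢ (Holds-other-block y (λ i≡j → j≢i (sym i≡j))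
          (⊨⇒Holds [ pos (a j) ] (var y i) (here refl) (respects-free j-free) ent))
      (no none) → ⊢a⇒⊢block y (⊢a-of-others-blocked i λ j j≢i →
        decidable-stable (blocked? j) λ j-free → none (j , j≢i , j-free))

    ⊢-of-violation : ∀ {i j y ℓ} → Blocked i → ¬ Blocked j → ℓ ∈ α →
                     ¬ Respected (pos (a j) ∷ pos (var y i) ∷ α) ℓ → ⊢ [ neg (var y i) ]
    ⊢-of-violation {ℓ = pos _} _ _ _ violated = contradiction tt violated
    ⊢-of-violation {i} {j} {y} {neg (var z k)} bl j-free n violated with k ≟F i | k ≟F j
    ... | yes refl | yes refl = contradiction bl j-free
    ... | yes refl | no i≢j = ⊢¬-of-seed-clash z bl n (Holds-other-block z i≢j h)
      where h = decidable-stable (holds? _ (var z k)) violated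
    ... | no _ | yes refl = contradiction (z , n) j-free
    ... | no k≢i | no k≢j = contradiction (Holds-other-block z k≢i (Holds-other-block z k≢j h)) (Holds-α-consistent n)
      where h = decidable-stable (holds? _ (var z k)) violated

    ⊢-of-⊨-neg-blocked : ∀ {i j} y → Blocked i → ¬ Blocked j → γ′ m ∧ α ⊨ neg (var y i) → ⊢ [ neg (var y i) ]
    ⊢-of-⊨-neg-blocked {i} {j} y bl j-free ent = decide (All.all? (respected? (β ++ α)) α)
      where
      β = pos (a j) ∷ pos (var y i) ∷ []

      decide : Dec (All (Respected (β ++ α)) α) → ⊢ [ neg (var y i) ]
      decide (yes respected) =
        contradiction (Holds-extensive (there (here refl))) (⊨⇒¬Holds β (var y i) (here refl) respected ent)
      decide (no ¬respected) =
        let _ , ℓ∈α , violated = find (¬All⇒Any¬ (respected? (β ++ α)) α ¬respected)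
        in ⊢-of-violation bl j-free ℓ∈α violated

    ⊢-of-⊨-neg : ∀ {i} y → γ′ m ∧ α ⊨ neg (var y i) → ⊢ [ neg (var y i) ]
    ⊢-of-⊨-neg {i} y ent = case blocked? i of λ where
      (yes bl) → ⊢-of-⊨-neg-blocked y bl (Product.proj₂ free) ent
      (no i-free) → contradiction (Holds-of-a y (here refl))
                      (⊨⇒¬Holds [ pos (a i) ] (var y i) (here refl) (respects-free i-free) ent)

    ⊢-of-⊨ : ∀ ℓ → γ′ m ∧ α ⊨ ℓ → ⊢ [ ℓ ]
    ⊢-of-⊨ (pos (var y _)) = ⊢-of-⊨-pos y
    ⊢-of-⊨ (neg (var y _)) = ⊢-of-⊨-neg y

  propagation-complete : ∀ ℓ → γ′ m ∧ α ⊨ ℓ → ⊢ [ ℓ ] ⊎ ⊢ []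
  propagation-complete ℓ ent = case conflict? of λ where
    (yes conflict) → inj₂ (⊢⊥-of-conflict conflict)
    (no ¬conflict) → inj₁ (ConflictFree.⊢-of-⊨ (λ k lc → ¬conflict (inj₁ (k , lc)))
                                               (¬∀⟶∃¬ m Blocked blocked? (λ all → ¬conflict (inj₂ all))) ℓ ent)

lemma5 : (m : ℕ) → 2 ≤ m → IsPC _≟G_ (γ′ m)
lemma5 m _ α α-consistent = Completeness.propagation-complete α α-consistent
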